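{- Let $S\subseteq[2n]$ be a signature and $(s(1),\dots,s(2n))$ its associated vector. Then the number of primary even-odd-descent permutations $\sigma\in\mathcal{X}_{2n}$ such that the set of descent tops and descent bottoms of $\sigma$ equals $S$ is $\prod_{i=1}^{2n} s(i)$.
   Context: $\mathcal{X}_{2n}$ is the set of permutations $\sigma=\sigma_1\cdots\sigma_{2n}$ of $[2n]$ such that every descent pair $(\sigma_i,\sigma_{i+1})$ (i.e. with $\sigma_i>\sigma_{i+1}$; $\sigma_i$ is the descent top and $\sigma_{i+1}$ the descent bottom) has $\sigma_i$ even and $\sigma_{i+1}$ odd. Such $\sigma$ with descent tops $\{t_1,\dots,t_k\}$ and descent bottoms $\{b_1,\dots,b_k\}$ is primary even-odd-descent if $t_i>b_j$ implies $t_i-b_j\ge 3$ for all $i,j$. A signature in $[2n]$ is a set $S\subseteq[2n]$ such that: (i) $S$ has $k$ odd and $k$ even elements for some $k\ge0$; (ii) for each $j\in[n]$, at most one of $2j-1,2j$ lies in $S$; (iii) for each $i\in[2n]$, $S\cap\{1,\dots,i\}$ contains at least as many odd as even elements. For $i\in[2n]$ let $f(i)$ (resp. $g(i)$) be the number of odd (resp. even) elements of $S$ less than $i$; the associated vector is given by $s(i)=f(i)-g(i)$ if $i\in S$ is even, and $s(i)=f(i)-g(i)+1$ otherwise (i.e. if $i\in S$ is odd or $i\notin S$). -}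

module Defs where

open import Data.Bool using (Bool; true; false; _∧_; not; if_then_else_)
open import Data.Nat using (ℕ; zero; suc; _+_; _*_; _∸_; _≤_; _<_; _≤ᵇ_)
open import Data.Integer as ℤ using (ℤ; +_)
open import Data.List using (List; []; _∷_; map; upTo; foldr)
open import Data.List.Membership.Propositional using (_∈_)
open import Data.List.Relation.Unary.All using (All)
open import Data.List.Relation.Binary.Permutation.Propositional using (_↭_)
open import Data.Product using (_×_; _,_; ∃-syntax)
open import Data.Sum using (_⊎_)
open import Relation.Binary.PropositionalEquality using (_≡_)
open import Relation.Nullary using (¬_)

isOdd : ℕ → Bool
isOdd zero = false
isOdd (suc n) = not (isOdd n)

isEven : ℕ → Bool
isEven n = not (isOdd n)

range : ℕ → List ℕ
range m = map suc (upTo m)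

IsPerm : ℕ → List ℕ → Set
IsPerm n σ = σ ↭ range (2 * n)

adjPairs : List ℕ → List (ℕ × ℕ)
adjPairs (x ∷ y ∷ r) = (x , y) ∷ adjPairs (y ∷ r)
adjPairs _ = []

IsDescentPair : List ℕ → ℕ → ℕ → Set
IsDescentPair σ a b = ((a , b) ∈ adjPairs σ) × (b < a)

DescentTop : List ℕ → ℕ → Set
DescentTop σ t = ∃[ b ] IsDescentPair σ t b

DescentBottom : List ℕ → ℕ → Set
DescentBottom σ b = ∃[ t ] IsDescentPair σ t b

InX : ℕ → List ℕ → Set
InX n σ = IsPerm n σ ×
  (∀ a b → IsDescentPair σ a b → (isEven a ≡ true) × (isOdd b ≡ true))

Primary : List ℕ → Set
Primary σ = ∀ t b → DescentTop σ t → DescentBottom σ b → b < t → 3 ≤ t ∸ b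

-- Signatures.  A subset S of ℕ is given by its (decidable) indicator.

-- number of j with 1 ≤ j < i, S j, and parity test p j
countBelow : (ℕ → Bool) → (ℕ → Bool) → ℕ → ℕ
countBelow S p zero = 0
countBelow S p (suc i) =
  countBelow S p i + (if (1 ≤ᵇ i) ∧ S i ∧ p i then 1 else 0)

fS : (ℕ → Bool) → ℕ → ℕ
fS S = countBelow S isOdd

gS : (ℕ → Bool) → ℕ → ℕ
gS S = countBelow S isEven

IsSignature : ℕ → (ℕ → Bool) → Set
IsSignature n S =
  (∀ x → S x ≡ true → (1 ≤ x) × (x ≤ 2 * n)) ×
  (fS S (suc (2 * n)) ≡ gS S (suc (2 * n))) ×
  (∀ j → 1 ≤ j → j ≤ n → ¬ ((S (2 * j ∸ 1) ≡ true) × (S (2 * j) ≡ true))) ×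
  (∀ i → 1 ≤ i → i ≤ 2 * n → gS S (suc i) ≤ fS S (suc i))

sVec : (ℕ → Bool) → ℕ → ℤ
sVec S i = if S i ∧ isEven i
           then (+ fS S i) ℤ.- (+ gS S i)
           else ((+ fS S i) ℤ.- (+ gS S i)) ℤ.+ (+ 1)

productℤ : List ℤ → ℤ
productℤ = foldr ℤ._*_ (+ 1)

DescentSetIs : List ℕ → (ℕ → Bool) → Set
DescentSetIs σ S = ∀ x → ((DescentTop σ x ⊎ DescentBottom σ x) → S x ≡ true)
                        × (S x ≡ true → (DescentTop σ x ⊎ DescentBottom σ x))

-- Build σ by inserting 1, 2, …, 2n in increasing order into a word in which 0 marks a
-- slot.  The word always ends in a slot; every other (inner) slot sits just before an odd
-- element of S still waiting for its descent top.  A letter i ∉ S is put in front of any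
-- slot; an odd i ∈ S replaces a slot by 0 i 0, opening an inner slot; an even i ∈ S fills
-- an inner slot and becomes the descent top of the letter after it.  With c inner slots
-- this leaves c + 1, c + 1 and c choices respectively, and c = f(i) - g(i), so step i has
-- s(i) choices.  Deleting the letters from the largest down recovers the choices, so each
-- σ ∈ 𝒳₂ₙ with descent set S is built exactly once; the signature conditions keep c ≥ 1
-- whenever a top is inserted and force c = 0 at the end, and parity together with
-- condition (ii) makes every such σ primary.

module Submission where

open import Defs
open import Data.Bool using (Bool; true; false; _∧_; not; if_then_else_)
open import Data.Bool.Properties using (not-involutive)
open import Data.Nat using (ℕ; zero; suc; _+_; _*_; _∸_; _≤_; _<_; z≤n; s≤s; _≟_; _≤?_; >-nonZero)
open import Data.Nat.Properties
open import Data.Integer as ℤ using (+_)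
import Data.Integer.Properties as ℤ
open import Data.List using (List; []; _∷_; _++_; _∷ʳ_; [_]; length; map; upTo; concatMap)
open import Data.List.Properties
  using (∷-injective; ∷-injectiveˡ; ∷-injectiveʳ; ++-assoc; ++-identityʳ; ∷ʳ-injectiveˡ;
         length-++; length-map; map-++; map-∘; map-id-local; upTo-∷ʳ)
open import Data.List.Membership.Propositional using (_∈_; _∉_; find; lose)
open import Data.List.Membership.Propositional.Properties
  using (∈-∃++; ∈-map⁺; ∈-map⁻; ∈-++⁺ʳ; ∈-concatMap⁺; ∈-concatMap⁻)
open import Data.List.Relation.Unary.Any using (here; there)
open import Data.List.Relation.Unary.All as All using (All; []; _∷_)
open import Data.List.Relation.Unary.AllPairs using ([]; _∷_)
open import Data.List.Relation.Unary.Unique.Propositional using (Unique)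
import Data.List.Relation.Unary.Unique.Propositional.Properties as Unique
open import Data.List.Relation.Binary.Permutation.Propositional as ↭ using (_↭_; ↭-sym)
open import Data.List.Relation.Binary.Permutation.Propositional.Properties using (shift)
open import Data.Product using (_×_; _,_; ∃-syntax; proj₁; proj₂)
open import Data.Sum using (_⊎_; inj₁; inj₂)
open import Data.Empty using (⊥; ⊥-elim)
open import Function using (_∘_; _∘′_)
open import Relation.Nullary using (¬_; yes; no)
open import Relation.Binary.Definitions using (DecidableEquality)
open import Relation.Binary.PropositionalEquality hiding ([_])

module Occurrences {a} {A : Set a} (_≟_ : DecidableEquality A) where

  occ : A → List A → ℕ
  occ x [] = 0
  occ x (y ∷ ys) with x ≟ y
  ... | yes _ = suc (occ x ys)
  ... | no _ = occ x ys

  occ-here : ∀ x ys → occ x (x ∷ ys) ≡ suc (occ x ys)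
  occ-here x ys with x ≟ x
  ... | yes _ = refl
  ... | no x≢x = ⊥-elim (x≢x refl)

  occ-there : ∀ {x y} ys → x ≢ y → occ x (y ∷ ys) ≡ occ x ys
  occ-there {x} {y} ys x≢y with x ≟ y
  ... | yes x≡y = ⊥-elim (x≢y x≡y)
  ... | no _ = refl

  occ-∷-cong : ∀ x y {ys zs} → occ x ys ≡ occ x zs → occ x (y ∷ ys) ≡ occ x (y ∷ zs)
  occ-∷-cong x y eq with x ≟ y
  ... | yes _ = cong suc eq
  ... | no _ = eq

  occ-∷-cancel : ∀ x y {ys zs} → occ x (y ∷ ys) ≡ occ x (y ∷ zs) → occ x ys ≡ occ x zs
  occ-∷-cancel x y eq with x ≟ y
  ... | yes _ = suc-injective eq
  ... | no _ = eq

  occ-++ : ∀ x xs ys → occ x (xs ++ ys) ≡ occ x xs + occ x ys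
  occ-++ x [] ys = refl
  occ-++ x (y ∷ xs) ys with x ≟ y
  ... | yes _ = cong suc (occ-++ x xs ys)
  ... | no _ = occ-++ x xs ys

  occ-++-∷ : ∀ x xs y ys → occ x (xs ++ y ∷ ys) ≡ occ x (y ∷ xs ++ ys)
  occ-++-∷ x xs y ys with x ≟ y
  ... | yes refl = begin
    occ x (xs ++ x ∷ ys)        ≡⟨ occ-++ x xs (x ∷ ys) ⟩
    occ x xs + occ x (x ∷ ys)   ≡⟨ cong (_+_ (occ x xs)) (occ-here x ys) ⟩
    occ x xs + suc (occ x ys)   ≡⟨ +-suc (occ x xs) (occ x ys) ⟩
    suc (occ x xs + occ x ys)   ≡⟨ cong suc (occ-++ x xs ys) ⟨
    suc (occ x (xs ++ ys))      ∎
    where open ≡-Reasoning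
  ... | no x≢y = begin
    occ x (xs ++ y ∷ ys)        ≡⟨ occ-++ x xs (y ∷ ys) ⟩
    occ x xs + occ x (y ∷ ys)   ≡⟨ cong (_+_ (occ x xs)) (occ-there ys x≢y) ⟩
    occ x xs + occ x ys         ≡⟨ occ-++ x xs ys ⟨
    occ x (xs ++ ys)            ∎
    where open ≡-Reasoning

  occ-++≡0ˡ : ∀ x xs ys → occ x (xs ++ ys) ≡ 0 → occ x xs ≡ 0
  occ-++≡0ˡ x xs ys eq = m+n≡0⇒m≡0 (occ x xs) (trans (sym (occ-++ x xs ys)) eq)

  occ-∷ʳ≡0 : ∀ x xs y ys → occ x (xs ++ y ∷ ys) ≡ 0 → occ x (xs ∷ʳ y) ≡ 0
  occ-∷ʳ≡0 x xs y ys eq = occ-++≡0ˡ x (xs ∷ʳ y) ys (trans (cong (occ x) (++-assoc xs [ y ] ys)) eq)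

  ∈⇒occ>0 : ∀ {x xs} → x ∈ xs → 0 < occ x xs
  ∈⇒occ>0 {x} {y ∷ xs} (here refl) rewrite occ-here x xs = s≤s z≤n
  ∈⇒occ>0 {x} {y ∷ xs} (there x∈xs) with x ≟ y
  ... | yes _ = s≤s z≤n
  ... | no _ = ∈⇒occ>0 x∈xs

  occ>0⇒∈ : ∀ {x} xs → 0 < occ x xs → x ∈ xs
  occ>0⇒∈ {x} (y ∷ xs) occ>0 with x ≟ y
  ... | yes x≡y = here x≡y
  ... | no _ = there (occ>0⇒∈ xs occ>0)

  occ≡0⇒∉ : ∀ {x} xs → occ x xs ≡ 0 → x ∉ xs
  occ≡0⇒∉ xs occ≡0 x∈xs with ∈⇒occ>0 x∈xs
  ... | occ>0 rewrite occ≡0 = <-irrefl refl occ>0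

  occ≡1⇒split : ∀ {x} xs → occ x xs ≡ 1 →
                ∃[ ys ] ∃[ zs ] (xs ≡ ys ++ x ∷ zs × occ x ys ≡ 0 × occ x zs ≡ 0)
  occ≡1⇒split {x} xs occ≡1 with ∈-∃++ (occ>0⇒∈ xs (subst (0 <_) (sym occ≡1) (s≤s z≤n)))
  ... | ys , zs , refl = ys , zs , refl , m+n≡0⇒m≡0 (occ x ys) rest≡0 , m+n≡0⇒n≡0 (occ x ys) rest≡0
    where
    rest≡0 : occ x ys + occ x zs ≡ 0
    rest≡0 = suc-injective (trans (sym (trans (occ-++-∷ x ys x zs)
               (trans (occ-here x (ys ++ zs)) (cong suc (occ-++ x ys zs))))) occ≡1)

  split-unique : ∀ {x} ys zs ys′ zs′ → occ x ys ≡ 0 → occ x ys′ ≡ 0 →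
                 ys ++ x ∷ zs ≡ ys′ ++ x ∷ zs′ → ys ≡ ys′ × zs ≡ zs′
  split-unique [] zs [] zs′ _ _ refl = refl , refl
  split-unique {x} [] zs (y ∷ ys′) zs′ _ occ≡0 eq with ∷-injective eq
  ... | refl , _ rewrite occ-here x ys′ = ⊥-elim (1+n≢0 occ≡0)
  split-unique {x} (y ∷ ys) zs [] zs′ occ≡0 _ eq with ∷-injective eq
  ... | refl , _ rewrite occ-here x ys = ⊥-elim (1+n≢0 occ≡0)
  split-unique {x} (y ∷ ys) zs (y′ ∷ ys′) zs′ occ≡0 occ′≡0 eq with ∷-injective eq
  ... | refl , eq′ with x ≟ y
  ... | yes _ = ⊥-elim (1+n≢0 occ≡0)
  ... | no _ with split-unique ys zs ys′ zs′ occ≡0 occ′≡0 eq′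
  ... | refl , refl = refl , refl

  occ-↭ : ∀ {xs ys} → xs ↭ ys → ∀ x → occ x xs ≡ occ x ys
  occ-↭ ↭.refl x = refl
  occ-↭ (↭.prep y p) x = occ-∷-cong x y (occ-↭ p x)
  occ-↭ (↭.swap y z p) x = trans (occ-++-∷ x (y ∷ []) z _) (occ-∷-cong x z (occ-∷-cong x y (occ-↭ p x)))
  occ-↭ (↭.trans p q) x = trans (occ-↭ p x) (occ-↭ q x)

  occ⇒↭ : ∀ xs ys → (∀ x → occ x xs ≡ occ x ys) → xs ↭ ys
  occ⇒↭ [] [] _ = ↭.refl
  occ⇒↭ [] (y ∷ ys) same = ⊥-elim (1+n≢0 (trans (sym (occ-here y ys)) (sym (same y))))
  occ⇒↭ (x ∷ xs) ys same
    with ∈-∃++ (occ>0⇒∈ ys (subst (0 <_) (same x) (∈⇒occ>0 {xs = x ∷ xs} (here refl))))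
  ... | ys₁ , ys₂ , refl = ↭.trans (↭.prep x (occ⇒↭ xs (ys₁ ++ ys₂) same′)) (↭-sym (shift x ys₁ ys₂))
    where
    same′ : ∀ z → occ z xs ≡ occ z (ys₁ ++ ys₂)
    same′ z = occ-∷-cancel z x (trans (same z) (occ-++-∷ z ys₁ x ys₂))

open Occurrences _≟_

module _ {a b} {A : Set a} {B : Set b} (f : A → List B) where

  length-concatMap-const : ∀ m xs → (∀ {x} → x ∈ xs → length (f x) ≡ m) →
                           length (concatMap f xs) ≡ length xs * m
  length-concatMap-const m [] _ = refl
  length-concatMap-const m (x ∷ xs) len≡m =
    trans (length-++ (f x)) (cong₂ _+_ (len≡m (here refl)) (length-concatMap-const m xs (len≡m ∘′ there)))

  Unique-concatMap⁺ : ∀ {xs} → Unique xs → (∀ {x} → x ∈ xs → Unique (f x)) →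
                      (∀ {x y z} → x ∈ xs → y ∈ xs → z ∈ f x → z ∈ f y → x ≡ y) →
                      Unique (concatMap f xs)
  Unique-concatMap⁺ {[]} [] _ _ = []
  Unique-concatMap⁺ {x ∷ xs} (x∉xs ∷ uxs) uf disjoint =
    Unique.++⁺ (uf (here refl))
      (Unique-concatMap⁺ uxs (λ y∈ → uf (there y∈)) (λ x∈ y∈ → disjoint (there x∈) (there y∈)))
      (λ (z∈fx , z∈rest) → let y , y∈xs , z∈fy = find (∈-concatMap⁻ f z∈rest) in
        All.lookup x∉xs y∈xs (disjoint (here refl) (there y∈xs) z∈fx z∈fy))

-- Words with slots

Adj : ℕ → ℕ → List ℕ → Set
Adj a b xs = (a , b) ∈ adjPairs xs

module _ {a b : ℕ} where

  Adj-++-∷⁻ : ∀ p x q → Adj a b (p ++ x ∷ q) → Adj a b (p ∷ʳ x) ⊎ Adj a b (x ∷ q)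
  Adj-++-∷⁻ [] x q ab = inj₂ ab
  Adj-++-∷⁻ (_ ∷ []) x q (here eq) = inj₁ (here eq)
  Adj-++-∷⁻ (_ ∷ []) x q (there ab) = inj₂ ab
  Adj-++-∷⁻ (_ ∷ _ ∷ _) x q (here eq) = inj₁ (here eq)
  Adj-++-∷⁻ (_ ∷ p@(_ ∷ _)) x q (there ab) with Adj-++-∷⁻ p x q ab
  ... | inj₁ ab′ = inj₁ (there ab′)
  ... | inj₂ ab′ = inj₂ ab′

  Adj-++-∷⁺ˡ : ∀ p x q → Adj a b (p ∷ʳ x) → Adj a b (p ++ x ∷ q)
  Adj-++-∷⁺ˡ (_ ∷ []) x q (here eq) = here eq
  Adj-++-∷⁺ˡ (_ ∷ _ ∷ _) x q (here eq) = here eq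
  Adj-++-∷⁺ˡ (_ ∷ p@(_ ∷ _)) x q (there ab) = there (Adj-++-∷⁺ˡ p x q ab)

  Adj-++⁺ʳ : ∀ p x q → Adj a b (x ∷ q) → Adj a b (p ++ x ∷ q)
  Adj-++⁺ʳ [] x q ab = ab
  Adj-++⁺ʳ (_ ∷ []) x q ab = there ab
  Adj-++⁺ʳ (_ ∷ p@(_ ∷ _)) x q ab = there (Adj-++⁺ʳ p x q ab)

  Adj-++⁺ˡ : ∀ p q → Adj a b p → Adj a b (p ++ q)
  Adj-++⁺ˡ (_ ∷ _ ∷ _) q (here eq) = here eq
  Adj-++⁺ˡ (_ ∷ p@(_ ∷ _)) q (there ab) = there (Adj-++⁺ˡ p q ab)

  Adj-∷ʳ⁻ : ∀ p x → Adj a b (p ∷ʳ x) → Adj a b p ⊎ (b ≡ x × ∃[ p′ ] p ≡ p′ ∷ʳ a)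
  Adj-∷ʳ⁻ (_ ∷ []) x (here refl) = inj₂ (refl , [] , refl)
  Adj-∷ʳ⁻ (_ ∷ _ ∷ _) x (here eq) = inj₁ (here eq)
  Adj-∷ʳ⁻ (y ∷ p@(_ ∷ _)) x (there ab) with Adj-∷ʳ⁻ p x ab
  ... | inj₁ ab′ = inj₁ (there ab′)
  ... | inj₂ (b≡x , p′ , eq) = inj₂ (b≡x , y ∷ p′ , cong (y ∷_) eq)

  Adj⇒∈ˡ : ∀ xs → Adj a b xs → a ∈ xs
  Adj⇒∈ˡ (_ ∷ _ ∷ _) (here refl) = here refl
  Adj⇒∈ˡ (_ ∷ xs@(_ ∷ _)) (there ab) = there (Adj⇒∈ˡ xs ab)

  Adj⇒∈ʳ : ∀ xs → Adj a b xs → b ∈ xs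
  Adj⇒∈ʳ (_ ∷ _ ∷ _) (here refl) = there (here refl)
  Adj⇒∈ʳ (_ ∷ xs@(_ ∷ _)) (there ab) = there (Adj⇒∈ʳ xs ab)

  Adj-∷ʳ-++ : ∀ p q → Adj a b ((p ∷ʳ a) ++ b ∷ q)
  Adj-∷ʳ-++ [] q = here refl
  Adj-∷ʳ-++ (_ ∷ []) q = there (here refl)
  Adj-∷ʳ-++ (_ ∷ p@(_ ∷ _)) q = there (Adj-∷ʳ-++ p q)

module _ {x : ℕ} where

  Adj-successor : ∀ {b} p r → occ x p ≡ 0 → occ x r ≡ 0 →
                  Adj x b (p ++ x ∷ r) → ∃[ q ] r ≡ b ∷ q
  Adj-successor p r x∉p x∉r xb with Adj-++-∷⁻ p x r xb
  ... | inj₁ xb′ with Adj-∷ʳ⁻ p x xb′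
  ... | inj₁ xb″ = ⊥-elim (occ≡0⇒∉ p x∉p (Adj⇒∈ˡ p xb″))
  ... | inj₂ (_ , p′ , refl) = ⊥-elim (occ≡0⇒∉ (p′ ∷ʳ x) x∉p (∈-++⁺ʳ p′ (here refl)))
  Adj-successor p (_ ∷ q) x∉p x∉r xb | inj₂ (here refl) = q , refl
  Adj-successor p r@(_ ∷ _) x∉p x∉r xb | inj₂ (there xb′) = ⊥-elim (occ≡0⇒∉ r x∉r (Adj⇒∈ˡ r xb′))

  Adj-predecessor : ∀ {a} p r → occ x p ≡ 0 → occ x r ≡ 0 →
                    Adj a x (p ++ x ∷ r) → ∃[ p′ ] p ≡ p′ ∷ʳ a
  Adj-predecessor p r x∉p x∉r ax with Adj-++-∷⁻ p x r ax
  ... | inj₁ ax′ with Adj-∷ʳ⁻ p x ax′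
  ... | inj₁ ax″ = ⊥-elim (occ≡0⇒∉ p x∉p (Adj⇒∈ʳ p ax″))
  ... | inj₂ (_ , p′ , eq) = p′ , eq
  Adj-predecessor p r@(_ ∷ _) x∉p x∉r ax | inj₂ (here refl) = ⊥-elim (occ≡0⇒∉ r x∉r (here refl))
  Adj-predecessor p r@(_ ∷ _) x∉p x∉r ax | inj₂ (there ax′) = ⊥-elim (occ≡0⇒∉ r x∉r (Adj⇒∈ʳ r ax′))

EndsWith0 : List ℕ → Set
EndsWith0 [] = ⊥
EndsWith0 (x ∷ []) = x ≡ 0
EndsWith0 (_ ∷ xs@(_ ∷ _)) = EndsWith0 xs

EndsWith0-++⁺ : ∀ p {xs} → EndsWith0 xs → EndsWith0 (p ++ xs)
EndsWith0-++⁺ [] e = e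
EndsWith0-++⁺ (_ ∷ []) {_ ∷ _} e = e
EndsWith0-++⁺ (_ ∷ p@(_ ∷ _)) e = EndsWith0-++⁺ p e

EndsWith0-++⁻ : ∀ p x q → EndsWith0 (p ++ x ∷ q) → EndsWith0 (x ∷ q)
EndsWith0-++⁻ [] x q e = e
EndsWith0-++⁻ (_ ∷ []) x q e = e
EndsWith0-++⁻ (_ ∷ p@(_ ∷ _)) x q e = EndsWith0-++⁻ p x q e

EndsWith0-∷ʳ : ∀ σ → EndsWith0 (σ ∷ʳ 0)
EndsWith0-∷ʳ σ = EndsWith0-++⁺ σ {[ 0 ]} refl

EndsWith0⇒∷ʳ : ∀ t → EndsWith0 t → ∃[ σ ] t ≡ σ ∷ʳ 0
EndsWith0⇒∷ʳ (_ ∷ []) refl = [] , refl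
EndsWith0⇒∷ʳ (x ∷ t@(_ ∷ _)) e with EndsWith0⇒∷ʳ t e
... | σ , eq = x ∷ σ , cong (x ∷_) eq

EndsWith0⇒occ0>0 : ∀ t → EndsWith0 t → 0 < occ 0 t
EndsWith0⇒occ0>0 t e with EndsWith0⇒∷ʳ t e
... | σ , refl = ∈⇒occ>0 (∈-++⁺ʳ σ (here refl))

rewriteSlot : (List ℕ → List ℕ) → List ℕ → List (List ℕ)
rewriteSlot f [] = []
rewriteSlot f (zero ∷ r) = f (zero ∷ r) ∷ map (zero ∷_) (rewriteSlot f r)
rewriteSlot f (suc x ∷ r) = map (suc x ∷_) (rewriteSlot f r)

fillSlot : ℕ → List ℕ → List (List ℕ)
fillSlot i [] = []
fillSlot i (zero ∷ []) = []
fillSlot i (zero ∷ y ∷ q) = (i ∷ y ∷ q) ∷ map (zero ∷_) (fillSlot i (y ∷ q))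
fillSlot i (suc x ∷ r) = map (suc x ∷_) (fillSlot i r)

openSlot : ℕ → List ℕ → List ℕ
openSlot i r = 0 ∷ i ∷ r

∈-rewriteSlot⁻ : ∀ f u {t} → t ∈ rewriteSlot f u →
                 ∃[ p ] ∃[ r ] (u ≡ p ++ 0 ∷ r × t ≡ p ++ f (0 ∷ r))
∈-rewriteSlot⁻ f (zero ∷ r) (here eq) = [] , r , refl , eq
∈-rewriteSlot⁻ f (zero ∷ r) (there t∈) with ∈-map⁻ _ t∈
... | _ , t′∈ , refl with ∈-rewriteSlot⁻ f r t′∈
...   | p , r′ , refl , refl = 0 ∷ p , r′ , refl , refl
∈-rewriteSlot⁻ f (suc x ∷ r) t∈ with ∈-map⁻ _ t∈
... | _ , t′∈ , refl with ∈-rewriteSlot⁻ f r t′∈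
...   | p , r′ , refl , refl = suc x ∷ p , r′ , refl , refl

∈-rewriteSlot⁺ : ∀ f p r → p ++ f (0 ∷ r) ∈ rewriteSlot f (p ++ 0 ∷ r)
∈-rewriteSlot⁺ f [] r = here refl
∈-rewriteSlot⁺ f (zero ∷ p) r = there (∈-map⁺ _ (∈-rewriteSlot⁺ f p r))
∈-rewriteSlot⁺ f (suc x ∷ p) r = ∈-map⁺ _ (∈-rewriteSlot⁺ f p r)

∈-fillSlot⁻ : ∀ i u {t} → t ∈ fillSlot i u →
              ∃[ p ] ∃[ y ] ∃[ q ] (u ≡ p ++ 0 ∷ y ∷ q × t ≡ p ++ i ∷ y ∷ q)
∈-fillSlot⁻ i (zero ∷ y ∷ q) (here eq) = [] , y , q , refl , eq
∈-fillSlot⁻ i (zero ∷ y ∷ q) (there t∈) with ∈-map⁻ _ t∈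
... | _ , t′∈ , refl with ∈-fillSlot⁻ i (y ∷ q) t′∈
...   | p , y′ , q′ , eq , refl = 0 ∷ p , y′ , q′ , cong (0 ∷_) eq , refl
∈-fillSlot⁻ i (suc x ∷ r) t∈ with ∈-map⁻ _ t∈
... | _ , t′∈ , refl with ∈-fillSlot⁻ i r t′∈
...   | p , y′ , q′ , refl , refl = suc x ∷ p , y′ , q′ , refl , refl

∈-fillSlot⁺ : ∀ i p y q → p ++ i ∷ y ∷ q ∈ fillSlot i (p ++ 0 ∷ y ∷ q)
∈-fillSlot⁺ i [] y q = here refl
∈-fillSlot⁺ i (zero ∷ []) y q = there (∈-map⁺ _ (here refl))
∈-fillSlot⁺ i (zero ∷ p@(_ ∷ _)) y q = there (∈-map⁺ _ (∈-fillSlot⁺ i p y q))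
∈-fillSlot⁺ i (suc x ∷ p) y q = ∈-map⁺ _ (∈-fillSlot⁺ i p y q)

length-rewriteSlot : ∀ f u → length (rewriteSlot f u) ≡ occ 0 u
length-rewriteSlot f [] = refl
length-rewriteSlot f (zero ∷ r) = cong suc (trans (length-map (zero ∷_) (rewriteSlot f r)) (length-rewriteSlot f r))
length-rewriteSlot f (suc x ∷ r) = trans (length-map (suc x ∷_) (rewriteSlot f r)) (length-rewriteSlot f r)

length-fillSlot : ∀ i u → EndsWith0 u → suc (length (fillSlot i u)) ≡ occ 0 u
length-fillSlot i (zero ∷ []) e = refl
length-fillSlot i (zero ∷ r@(_ ∷ _)) e =
  cong suc (trans (cong suc (length-map (zero ∷_) (fillSlot i r))) (length-fillSlot i r e))
length-fillSlot i (suc x ∷ r@(_ ∷ _)) e =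
  trans (cong suc (length-map (suc x ∷_) (fillSlot i r))) (length-fillSlot i r e)

private
  All-≢-map-0∷ : ∀ {w : List ℕ} ys → (∀ z → w ≢ 0 ∷ z) → All (w ≢_) (map (0 ∷_) ys)
  All-≢-map-0∷ [] _ = []
  All-≢-map-0∷ (y ∷ ys) w≢ = w≢ y ∷ All-≢-map-0∷ ys w≢

Unique-rewriteSlot-∷ : ∀ k u → Unique (rewriteSlot (suc k ∷_) u)
Unique-rewriteSlot-∷ k [] = []
Unique-rewriteSlot-∷ k (zero ∷ r) =
  All-≢-map-0∷ (rewriteSlot (suc k ∷_) r) (λ _ ()) ∷ Unique.map⁺ ∷-injectiveʳ (Unique-rewriteSlot-∷ k r)
Unique-rewriteSlot-∷ k (suc x ∷ r) = Unique.map⁺ ∷-injectiveʳ (Unique-rewriteSlot-∷ k r)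

Unique-fillSlot : ∀ k u → Unique (fillSlot (suc k) u)
Unique-fillSlot k [] = []
Unique-fillSlot k (zero ∷ []) = []
Unique-fillSlot k (zero ∷ r@(_ ∷ _)) =
  All-≢-map-0∷ (fillSlot (suc k) r) (λ _ ()) ∷ Unique.map⁺ ∷-injectiveʳ (Unique-fillSlot k r)
Unique-fillSlot k (suc x ∷ r) = Unique.map⁺ ∷-injectiveʳ (Unique-fillSlot k r)

-- The results differ in where the unique letter i sits.
Unique-rewriteSlot-open : ∀ k u → occ (suc k) u ≡ 0 → Unique (rewriteSlot (openSlot (suc k)) u)
Unique-rewriteSlot-open k [] _ = []
Unique-rewriteSlot-open k (zero ∷ r) i∉r =
  first≢rest (rewriteSlot (openSlot (suc k)) r) (λ _ → ∈-rewriteSlot⁻ _ r)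
  ∷ Unique.map⁺ ∷-injectiveʳ (Unique-rewriteSlot-open k r i∉r)
  where
  first≢rest : ∀ ys →
               (∀ y → y ∈ ys → ∃[ p ] ∃[ r′ ] (r ≡ p ++ 0 ∷ r′ × y ≡ p ++ openSlot (suc k) (0 ∷ r′))) →
               All (openSlot (suc k) (0 ∷ r) ≢_) (map (0 ∷_) ys)
  first≢rest [] _ = []
  first≢rest (y ∷ ys) shape =
    differ (shape y (here refl)) ∷ first≢rest ys (λ y′ y′∈ → shape y′ (there y′∈))
    where
    differ : ∃[ p ] ∃[ r′ ] (r ≡ p ++ 0 ∷ r′ × y ≡ p ++ openSlot (suc k) (0 ∷ r′)) →
             openSlot (suc k) (0 ∷ r) ≢ 0 ∷ y
    differ ([] , r′ , _ , refl) ()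
    differ (x ∷ p , r′ , refl , refl) eq with ∷-injectiveˡ (∷-injectiveʳ eq)
    ... | refl rewrite occ-here (suc k) (p ++ 0 ∷ r′) = 1+n≢0 i∉r
Unique-rewriteSlot-open k (suc x ∷ r) i∉r with suc k ≟ suc x
... | yes _ = ⊥-elim (1+n≢0 i∉r)
... | no _ = Unique.map⁺ ∷-injectiveʳ (Unique-rewriteSlot-open k r i∉r)

occ-0∷ : ∀ {x} ys → 1 ≤ x → occ x (0 ∷ ys) ≡ occ x ys
occ-0∷ ys (s≤s _) = occ-there {y = 0} ys (λ ())

occ-open : ∀ x p i r → occ x (p ++ openSlot i (0 ∷ r)) ≡ occ x (0 ∷ i ∷ p ++ 0 ∷ r)
occ-open x p i r = trans (occ-++-∷ x p 0 (i ∷ 0 ∷ r)) (occ-∷-cong x 0 (occ-++-∷ x p i (0 ∷ r)))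

occ-fill : ∀ x p i y q → 1 ≤ x → occ x (p ++ i ∷ y ∷ q) ≡ occ x (i ∷ p ++ 0 ∷ y ∷ q)
occ-fill x p i y q 1≤x = trans (occ-++-∷ x p i (y ∷ q))
  (occ-∷-cong x i (trans (sym (occ-0∷ (p ++ y ∷ q) 1≤x)) (sym (occ-++-∷ x p 0 (y ∷ q)))))

occ⇒≡[0] : ∀ t → (∀ x → 0 < x → occ x t ≡ 0) → occ 0 t ≡ 1 → t ≡ [ 0 ]
occ⇒≡[0] (zero ∷ []) _ _ = refl
occ⇒≡[0] (zero ∷ zero ∷ t) _ occ≡1 = ⊥-elim (1+n≢0 (suc-injective occ≡1))
occ⇒≡[0] (zero ∷ suc y ∷ t) none _ =
  ⊥-elim (1+n≢0 (trans (sym (occ-here (suc y) t)) (none (suc y) (s≤s z≤n))))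
occ⇒≡[0] (suc y ∷ t) none _ =
  ⊥-elim (1+n≢0 (trans (sym (occ-here (suc y) t)) (none (suc y) (s≤s z≤n))))

rewriteSlot-∷-injective : ∀ {i u v t} → occ i u ≡ 0 → occ i v ≡ 0 →
                          t ∈ rewriteSlot (i ∷_) u → t ∈ rewriteSlot (i ∷_) v → u ≡ v
rewriteSlot-∷-injective {i} {u} {v} i∉u i∉v t∈u t∈v
  with ∈-rewriteSlot⁻ _ u t∈u | ∈-rewriteSlot⁻ _ v t∈v
... | p , r , refl , refl | p′ , r′ , refl , eq
  with split-unique p (0 ∷ r) p′ (0 ∷ r′) (occ-++≡0ˡ i p _ i∉u) (occ-++≡0ˡ i p′ _ i∉v) eq
...   | refl , refl = refl

rewriteSlot-open-injective : ∀ {k u v t} → occ (suc k) u ≡ 0 → occ (suc k) v ≡ 0 →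
                             t ∈ rewriteSlot (openSlot (suc k)) u → t ∈ rewriteSlot (openSlot (suc k)) v → u ≡ v
rewriteSlot-open-injective {k} {u} {v} i∉u i∉v t∈u t∈v
  with ∈-rewriteSlot⁻ _ u t∈u | ∈-rewriteSlot⁻ _ v t∈v
... | p , r , refl , refl | p′ , r′ , refl , eq
  with split-unique (p ∷ʳ 0) (0 ∷ r) (p′ ∷ʳ 0) (0 ∷ r′)
         (occ-∷ʳ≡0 (suc k) p 0 r i∉u) (occ-∷ʳ≡0 (suc k) p′ 0 r′ i∉v)
         (trans (++-assoc p [ 0 ] _) (trans eq (sym (++-assoc p′ [ 0 ] _))))
...   | p0≡p′0 , refl with ∷ʳ-injectiveˡ p p′ p0≡p′0
...     | refl = refl

fillSlot-injective : ∀ {i u v t} → occ i u ≡ 0 → occ i v ≡ 0 →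
                     t ∈ fillSlot i u → t ∈ fillSlot i v → u ≡ v
fillSlot-injective {i} {u} {v} i∉u i∉v t∈u t∈v with ∈-fillSlot⁻ _ u t∈u | ∈-fillSlot⁻ _ v t∈v
... | p , y , q , refl , refl | p′ , y′ , q′ , refl , eq
  with split-unique p (y ∷ q) p′ (y′ ∷ q′) (occ-++≡0ˡ i p _ i∉u) (occ-++≡0ˡ i p′ _ i∉v) eq
...   | refl , refl = refl

-- Building the words letter by letter

data Kind : Set where
  free bottom top : Kind

kindOf : Bool → Bool → Kind
kindOf false _ = free
kindOf true true = bottom
kindOf true false = top

nextInnerSlots : Kind → ℕ → ℕ
nextInnerSlots free c = c
nextInnerSlots bottom c = suc c
nextInnerSlots top c = c ∸ 1

choices : Kind → ℕ → ℕ
choices top c = c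
choices _ c = suc c

record LettersUpTo (i : ℕ) (t : List ℕ) : Set where
  field
    once : ∀ x → 1 ≤ x → x ≤ i → occ x t ≡ 1
    none : ∀ x → i < x → occ x t ≡ 0

open LettersUpTo


∈⇒≤ : ∀ {i t x} → LettersUpTo i t → x ∈ t → x ≤ i
∈⇒≤ {x = zero} _ _ = z≤n
∈⇒≤ {i} {t} {suc x} ok x∈t with suc x ≤? i
... | yes x≤i = x≤i
... | no x≰i = ⊥-elim (occ≡0⇒∉ t (none ok (suc x) (≰⇒> x≰i)) x∈t)

∈⇒≯ : ∀ {i t x} → LettersUpTo i t → x ∈ t → ¬ (i < x)
∈⇒≯ ok x∈t = ≤⇒≯ (∈⇒≤ ok x∈t)

LettersUpTo-insert : ∀ {k u t} → LettersUpTo k u →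
                     (∀ x → 1 ≤ x → occ x t ≡ occ x (suc k ∷ u)) → LettersUpTo (suc k) t
once (LettersUpTo-insert {k} {u} ok same) x 1≤x x≤ with x ≟ suc k
... | yes refl = trans (same x 1≤x) (trans (occ-here x u) (cong suc (none ok x ≤-refl)))
... | no x≢ = trans (same x 1≤x) (trans (occ-there u x≢) (once ok x 1≤x (≤-pred (≤∧≢⇒< x≤ x≢))))
none (LettersUpTo-insert {k} {u} ok same) x lt =
  trans (same x (≤-trans (s≤s z≤n) lt))
    (trans (occ-there u (λ eq → <-irrefl (sym eq) lt)) (none ok x (<-trans (n<1+n k) lt)))

LettersUpTo-remove : ∀ {k u t} → LettersUpTo (suc k) t →
                     (∀ x → 1 ≤ x → occ x t ≡ occ x (suc k ∷ u)) → LettersUpTo k u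
once (LettersUpTo-remove {k} {u} ok same) x 1≤x x≤ =
  trans (sym (occ-there u (λ eq → <-irrefl eq (s≤s x≤))))
    (trans (sym (same x 1≤x)) (once ok x 1≤x (m≤n⇒m≤1+n x≤)))
none (LettersUpTo-remove {k} {u} ok same) x lt with x ≟ suc k
... | yes refl = suc-injective (trans (sym (occ-here x u)) (trans (sym (same x 1≤x)) (once ok x 1≤x ≤-refl)))
  where 1≤x = ≤-trans (s≤s z≤n) lt
... | no x≢ = trans (sym (occ-there u x≢)) (trans (sym (same x 1≤x)) (none ok x (≤∧≢⇒< lt (x≢ ∘ sym))))
  where 1≤x = ≤-trans (s≤s z≤n) lt

module Construction (S : ℕ → Bool) where

  kind : ℕ → Kind
  kind i = kindOf (S i) (isOdd i)

  Bottom : ℕ → Set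
  Bottom b = isOdd b ≡ true × S b ≡ true

  Top : ℕ → Set
  Top a = isOdd a ≡ false × S a ≡ true

  free⇒∉S : ∀ i → kind i ≡ free → S i ≡ true → ⊥
  free⇒∉S i eq i∈S with S i | isOdd i
  free⇒∉S i () i∈S | true | true
  free⇒∉S i () i∈S | true | false

  bottom⇒Bottom : ∀ i → kind i ≡ bottom → Bottom i
  bottom⇒Bottom i eq with S i | isOdd i
  bottom⇒Bottom i () | false | _
  bottom⇒Bottom i eq | true | true = refl , refl
  bottom⇒Bottom i () | true | false

  top⇒Top : ∀ i → kind i ≡ top → Top i
  top⇒Top i eq with S i | isOdd i
  top⇒Top i () | false | _
  top⇒Top i () | true | true
  top⇒Top i eq | true | false = refl , refl

  ¬Bottom×Top : ∀ {x} → Bottom x → Top x → ⊥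
  ¬Bottom×Top (odd , _) (even , _) with trans (sym odd) even
  ... | ()

  innerSlots : ℕ → ℕ
  innerSlots zero = 0
  innerSlots (suc k) = nextInnerSlots (kind (suc k)) (innerSlots k)

  innerSlots-suc : ∀ k {K} → kind (suc k) ≡ K → innerSlots (suc k) ≡ nextInnerSlots K (innerSlots k)
  innerSlots-suc k eq = cong (λ K → nextInnerSlots K (innerSlots k)) eq

  insert : Kind → ℕ → List ℕ → List (List ℕ)
  insert free i = rewriteSlot (i ∷_)
  insert bottom i = rewriteSlot (openSlot i)
  insert top i = fillSlot i

  words : ℕ → List (List ℕ)
  words zero = [ [ 0 ] ]
  words (suc k) = concatMap (insert (kind (suc k)) (suc k)) (words k)

  -- A pair b < a with b ≠ 0 is already a descent of the final permutation, and a slot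
  -- always precedes a bottom that still waits for its top.
  GoodPair : ℕ → ℕ → Set
  GoodPair a b = (1 ≤ b → b < a → Top a × Bottom b) × (a ≡ 0 → Bottom b)

  -- x is a descent top, or a descent bottom whose top may still be a slot.
  Witness : ℕ → ℕ → ℕ → Set
  Witness x a b = (a ≡ x × 1 ≤ b × b < x) ⊎ (b ≡ x × (a ≡ 0 ⊎ x < a))

  InDescent : List ℕ → ℕ → Set
  InDescent t x = ∃[ a ] ∃[ b ] (Adj a b t × Witness x a b)

  record WellFormed (i : ℕ) (t : List ℕ) : Set where
    field
      letters : LettersUpTo i t
      good : ∀ a b → Adj a b t → GoodPair a b
      inDescent : ∀ x → 1 ≤ x → x ≤ i → S x ≡ true → InDescent t x
      endsWith0 : EndsWith0 t
      slots : occ 0 t ≡ suc (innerSlots i)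

  open WellFormed

  ¬Adj00 : ∀ {i t} → WellFormed i t → ¬ Adj 0 0 t
  ¬Adj00 wf 00∈t with proj₂ (good wf 0 0 00∈t) refl
  ... | () , _

  Bottom⇒>0 : ∀ {b} → Bottom b → 1 ≤ b
  Bottom⇒>0 {zero} (() , _)
  Bottom⇒>0 {suc b} _ = s≤s z≤n

  Witness⇒>0 : ∀ {x a b} → Witness x a b → 1 ≤ x → 1 ≤ b
  Witness⇒>0 (inj₁ (_ , 1≤b , _)) _ = 1≤b
  Witness⇒>0 (inj₂ (refl , _)) 1≤x = 1≤x

  wf-insert-free : ∀ {k u t} → kind (suc k) ≡ free → WellFormed k u →
                   t ∈ rewriteSlot (suc k ∷_) u → WellFormed (suc k) t
  wf-insert-free {k} {u} kind≡ wf t∈ with ∈-rewriteSlot⁻ (suc k ∷_) u t∈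
  ... | p , r , refl , refl = record
    { letters = LettersUpTo-insert (letters wf) (λ x _ → occ-++-∷ x p (suc k) (0 ∷ r))
    ; good = good′
    ; inDescent = inDescent′
    ; endsWith0 = EndsWith0-++⁺ p (EndsWith0-++⁻ p 0 r (endsWith0 wf))
    ; slots = trans (occ-++-∷ 0 p (suc k) (0 ∷ r)) (trans (slots wf) (cong suc (sym (innerSlots-suc k kind≡))))
    }
    where
    good′ : ∀ a b → Adj a b (p ++ suc k ∷ 0 ∷ r) → GoodPair a b
    good′ a b ab with Adj-++-∷⁻ p (suc k) (0 ∷ r) ab
    ... | inj₁ ab′ with Adj-∷ʳ⁻ p (suc k) ab′
    ... | inj₁ ab″ = good wf a b (Adj-++⁺ˡ p (0 ∷ r) ab″)
    ... | inj₂ (refl , p′ , refl) =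
          (λ _ i<a → ⊥-elim (∈⇒≯ (letters wf) (Adj⇒∈ˡ _ (Adj-∷ʳ-++ p′ r)) (<⇒≤ i<a)))
        , (λ { refl → ⊥-elim (¬Adj00 wf (Adj-∷ʳ-++ p′ r)) })
    good′ a b ab | inj₂ (here refl) = (λ ()) , (λ ())
    good′ a b ab | inj₂ (there ab′) = good wf a b (Adj-++⁺ʳ p 0 r ab′)

    transport : ∀ a b → 1 ≤ b → Adj a b (p ++ 0 ∷ r) → Adj a b (p ++ suc k ∷ 0 ∷ r)
    transport a b 1≤b ab with Adj-++-∷⁻ p 0 r ab
    ... | inj₁ ab′ with Adj-∷ʳ⁻ p 0 ab′
    ... | inj₁ ab″ = Adj-++⁺ˡ p (suc k ∷ 0 ∷ r) ab″
    ... | inj₂ (refl , _) = ⊥-elim (<-irrefl refl 1≤b)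
    transport a b 1≤b ab | inj₂ ab′ = Adj-++⁺ʳ p (suc k) (0 ∷ r) (there ab′)

    inDescent′ : ∀ x → 1 ≤ x → x ≤ suc k → S x ≡ true → InDescent (p ++ suc k ∷ 0 ∷ r) x
    inDescent′ x 1≤x x≤ x∈S with x ≟ suc k
    ... | yes refl = ⊥-elim (free⇒∉S (suc k) kind≡ x∈S)
    ... | no x≢ with inDescent wf x 1≤x (≤-pred (≤∧≢⇒< x≤ x≢)) x∈S
    ... | a , b , ab , w = a , b , transport a b (Witness⇒>0 w 1≤x) ab , w

  wf-insert-bottom : ∀ {k u t} → kind (suc k) ≡ bottom → WellFormed k u →
                     t ∈ rewriteSlot (openSlot (suc k)) u → WellFormed (suc k) t
  wf-insert-bottom {k} {u} kind≡ wf t∈ with ∈-rewriteSlot⁻ (openSlot (suc k)) u t∈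
  ... | p , r , refl , refl = record
    { letters = LettersUpTo-insert (letters wf) λ x 1≤x →
        trans (occ-open x p (suc k) r) (occ-0∷ (suc k ∷ p ++ 0 ∷ r) 1≤x)
    ; good = good′
    ; inDescent = inDescent′
    ; endsWith0 = EndsWith0-++⁺ p (EndsWith0-++⁻ p 0 r (endsWith0 wf))
    ; slots = trans (occ-open 0 p (suc k) r) (cong suc (trans (slots wf) (sym (innerSlots-suc k kind≡))))
    }
    where
    good′ : ∀ a b → Adj a b (p ++ 0 ∷ suc k ∷ 0 ∷ r) → GoodPair a b
    good′ a b ab with Adj-++-∷⁻ p 0 (suc k ∷ 0 ∷ r) ab
    ... | inj₁ ab′ = good wf a b (Adj-++-∷⁺ˡ p 0 r ab′)
    ... | inj₂ (here refl) = (λ _ ()) , (λ _ → bottom⇒Bottom (suc k) kind≡)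
    ... | inj₂ (there (here refl)) = (λ ()) , (λ ())
    ... | inj₂ (there (there ab′)) = good wf a b (Adj-++⁺ʳ p 0 r ab′)

    transport : ∀ a b → Adj a b (p ++ 0 ∷ r) → Adj a b (p ++ 0 ∷ suc k ∷ 0 ∷ r)
    transport a b ab with Adj-++-∷⁻ p 0 r ab
    ... | inj₁ ab′ = Adj-++-∷⁺ˡ p 0 (suc k ∷ 0 ∷ r) ab′
    ... | inj₂ ab′ = Adj-++⁺ʳ p 0 (suc k ∷ 0 ∷ r) (there (there ab′))

    inDescent′ : ∀ x → 1 ≤ x → x ≤ suc k → S x ≡ true → InDescent (p ++ 0 ∷ suc k ∷ 0 ∷ r) x
    inDescent′ x 1≤x x≤ x∈S with x ≟ suc k
    ... | yes refl = 0 , x , Adj-++⁺ʳ p 0 (x ∷ 0 ∷ r) (here refl) , inj₂ (refl , inj₁ refl)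
    ... | no x≢ with inDescent wf x 1≤x (≤-pred (≤∧≢⇒< x≤ x≢)) x∈S
    ... | a , b , ab , w = a , b , transport a b ab , w

  wf-insert-top : ∀ {k u t} → kind (suc k) ≡ top → WellFormed k u →
                  t ∈ fillSlot (suc k) u → WellFormed (suc k) t
  wf-insert-top {k} {u} kind≡ wf t∈ with ∈-fillSlot⁻ (suc k) u t∈
  ... | p , y , q , refl , refl = record
    { letters = LettersUpTo-insert (letters wf) (occ-fill′)
    ; good = good′
    ; inDescent = inDescent′
    ; endsWith0 = EndsWith0-++⁺ p (EndsWith0-++⁻ p 0 (y ∷ q) (endsWith0 wf))
    ; slots = slots′
    }
    where
    occ-fill′ : ∀ x → 1 ≤ x → occ x (p ++ suc k ∷ y ∷ q) ≡ occ x (suc k ∷ p ++ 0 ∷ y ∷ q)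
    occ-fill′ x = occ-fill x p (suc k) y q

    0y : Adj 0 y (p ++ 0 ∷ y ∷ q)
    0y = Adj-++⁺ʳ p 0 (y ∷ q) (here refl)

    bottom-y : Bottom y
    bottom-y = proj₂ (good wf 0 y 0y) refl

    y<i : y < suc k
    y<i = s≤s (∈⇒≤ (letters wf) (Adj⇒∈ʳ _ 0y))

    good′ : ∀ a b → Adj a b (p ++ suc k ∷ y ∷ q) → GoodPair a b
    good′ a b ab with Adj-++-∷⁻ p (suc k) (y ∷ q) ab
    ... | inj₁ ab′ with Adj-∷ʳ⁻ p (suc k) ab′
    ... | inj₁ ab″ = good wf a b (Adj-++⁺ˡ p (0 ∷ y ∷ q) ab″)
    ... | inj₂ (refl , p′ , refl) =
          (λ _ i<a → ⊥-elim (∈⇒≯ (letters wf) (Adj⇒∈ˡ _ (Adj-∷ʳ-++ p′ (y ∷ q))) (<⇒≤ i<a)))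
        , (λ { refl → ⊥-elim (¬Adj00 wf (Adj-∷ʳ-++ p′ (y ∷ q))) })
    good′ a b ab | inj₂ (here refl) = (λ _ _ → top⇒Top (suc k) kind≡ , bottom-y) , (λ ())
    good′ a b ab | inj₂ (there ab′) = good wf a b (Adj-++⁺ʳ p 0 (y ∷ q) (there ab′))

    -- Only the pair (0 , y) is destroyed; it becomes (suc k , y).
    transport : ∀ a b → 1 ≤ b → Adj a b (p ++ 0 ∷ y ∷ q) →
                Adj a b (p ++ suc k ∷ y ∷ q) ⊎ (a ≡ 0 × b ≡ y)
    transport a b 1≤b ab with Adj-++-∷⁻ p 0 (y ∷ q) ab
    ... | inj₁ ab′ with Adj-∷ʳ⁻ p 0 ab′
    ... | inj₁ ab″ = inj₁ (Adj-++⁺ˡ p (suc k ∷ y ∷ q) ab″)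
    ... | inj₂ (refl , _) = ⊥-elim (<-irrefl refl 1≤b)
    transport a b 1≤b ab | inj₂ (here refl) = inj₂ (refl , refl)
    transport a b 1≤b ab | inj₂ (there ab′) = inj₁ (Adj-++⁺ʳ p (suc k) (y ∷ q) (there ab′))

    inDescent′ : ∀ x → 1 ≤ x → x ≤ suc k → S x ≡ true → InDescent (p ++ suc k ∷ y ∷ q) x
    inDescent′ x 1≤x x≤ x∈S with x ≟ suc k
    ... | yes refl = x , y , Adj-++⁺ʳ p x (y ∷ q) (here refl) , inj₁ (refl , Bottom⇒>0 bottom-y , y<i)
    ... | no x≢ with inDescent wf x 1≤x (≤-pred (≤∧≢⇒< x≤ x≢)) x∈S
    ... | a , b , ab , w with transport a b (Witness⇒>0 w 1≤x) ab
    ... | inj₁ ab′ = a , b , ab′ , w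
    ... | inj₂ (refl , refl) with w
    ... | inj₁ (refl , _) = ⊥-elim (<-irrefl refl 1≤x)
    ... | inj₂ (refl , _) = suc k , y , Adj-++⁺ʳ p (suc k) (y ∷ q) (here refl) , inj₂ (refl , inj₂ y<i)

    slots-u : occ 0 (p ++ y ∷ q) ≡ innerSlots k
    slots-u = suc-injective (trans (sym (occ-++-∷ 0 p 0 (y ∷ q))) (slots wf))

    slots′ : occ 0 (p ++ suc k ∷ y ∷ q) ≡ suc (innerSlots (suc k))
    slots′ = begin
      occ 0 (p ++ suc k ∷ y ∷ q)   ≡⟨ occ-++-∷ 0 p (suc k) (y ∷ q) ⟩
      occ 0 (p ++ y ∷ q)           ≡⟨ suc-pred _ ⦃ >-nonZero (EndsWith0⇒occ0>0 (p ++ y ∷ q) (EndsWith0-++⁺ p (EndsWith0-++⁻ p 0 (y ∷ q) (endsWith0 wf)))) ⦄ ⟨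
      suc (occ 0 (p ++ y ∷ q) ∸ 1) ≡⟨ cong (λ c → suc (c ∸ 1)) slots-u ⟩
      suc (innerSlots k ∸ 1)       ≡⟨ cong suc (innerSlots-suc k kind≡) ⟨
      suc (innerSlots (suc k))     ∎
      where open ≡-Reasoning

  -- Removal of the largest letter inverts insertion.

  maxLetter-split : ∀ {k t} → WellFormed (suc k) t →
                    ∃[ p ] ∃[ r ] (t ≡ p ++ suc k ∷ r × occ (suc k) p ≡ 0 × occ (suc k) r ≡ 0)
  maxLetter-split {k} {t} wf = occ≡1⇒split t (once (letters wf) (suc k) (s≤s z≤n) ≤-refl)

  maxLetter-followedBySlot : ∀ {k t} → WellFormed (suc k) t → ¬ Top (suc k) →
                             ∃[ p ] ∃[ q ] (t ≡ p ++ suc k ∷ 0 ∷ q × occ (suc k) p ≡ 0 × occ (suc k) q ≡ 0)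
  maxLetter-followedBySlot wf ¬top with maxLetter-split wf
  ... | p , [] , refl , _ , _ with EndsWith0-++⁻ p _ [] (endsWith0 wf)
  ...   | ()
  maxLetter-followedBySlot wf ¬top | p , zero ∷ q , refl , i∉p , i∉q = p , q , refl , i∉p , i∉q
  maxLetter-followedBySlot {k} {t} wf ¬top | p , suc y ∷ q , refl , _ , i∉r =
    ⊥-elim (¬top (proj₁ (proj₁ (good wf _ _ iy) (s≤s z≤n) (≤∧≢⇒< (∈⇒≤ (letters wf) (Adj⇒∈ʳ t iy)) y≢k))))
    where
    iy : Adj (suc k) (suc y) t
    iy = Adj-++⁺ʳ p (suc k) (suc y ∷ q) (here refl)
    y≢k : suc y ≢ suc k
    y≢k eq = occ≡0⇒∉ (suc y ∷ q) i∉r (here (sym eq))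

  wf-remove-free : ∀ {k t} → kind (suc k) ≡ free → WellFormed (suc k) t →
                   ∃[ u ] (WellFormed k u × t ∈ rewriteSlot (suc k ∷_) u)
  wf-remove-free {k} kind≡ wf with maxLetter-followedBySlot wf (λ (_ , i∈S) → free⇒∉S (suc k) kind≡ i∈S)
  ... | p , q , refl , _ , _ = p ++ 0 ∷ q , record
    { letters = LettersUpTo-remove (letters wf) (λ x _ → occ-++-∷ x p (suc k) (0 ∷ q))
    ; good = good′
    ; inDescent = inDescent′
    ; endsWith0 = EndsWith0-++⁺ p (EndsWith0-++⁻ p (suc k) (0 ∷ q) (endsWith0 wf))
    ; slots = trans (sym (occ-++-∷ 0 p (suc k) (0 ∷ q))) (trans (slots wf) (cong suc (innerSlots-suc k kind≡)))
    } , ∈-rewriteSlot⁺ (suc k ∷_) p q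
    where
    good′ : ∀ a b → Adj a b (p ++ 0 ∷ q) → GoodPair a b
    good′ a b ab with Adj-++-∷⁻ p 0 q ab
    ... | inj₁ ab′ with Adj-∷ʳ⁻ p 0 ab′
    ... | inj₁ ab″ = good wf a b (Adj-++⁺ˡ p (suc k ∷ 0 ∷ q) ab″)
    ... | inj₂ (refl , p′ , refl) =
          (λ ())
        , (λ { refl → ⊥-elim (free⇒∉S (suc k) kind≡ (proj₂ (proj₂ (good wf 0 (suc k) (Adj-∷ʳ-++ p′ (0 ∷ q))) refl))) })
    good′ a b ab | inj₂ ab′ = good wf a b (Adj-++⁺ʳ p (suc k) (0 ∷ q) (there ab′))

    transport : ∀ x a b → 1 ≤ x → x ≤ k → Witness x a b →
                Adj a b (p ++ suc k ∷ 0 ∷ q) → Adj a b (p ++ 0 ∷ q)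
    transport x a b 1≤x x≤ w ab with Adj-++-∷⁻ p (suc k) (0 ∷ q) ab
    ... | inj₁ ab′ with Adj-∷ʳ⁻ p (suc k) ab′
    ... | inj₁ ab″ = Adj-++⁺ˡ p (0 ∷ q) ab″
    ... | inj₂ (refl , _) with w
    ... | inj₁ (_ , _ , i<x) = ⊥-elim (<⇒≱ i<x (m≤n⇒m≤1+n x≤))
    ... | inj₂ (refl , _) = ⊥-elim (<-irrefl refl x≤)
    transport x a b 1≤x x≤ w ab | inj₂ (here refl) with w
    ... | inj₁ (refl , _) = ⊥-elim (<-irrefl refl x≤)
    ... | inj₂ (refl , _) = ⊥-elim (<-irrefl refl 1≤x)
    transport x a b 1≤x x≤ w ab | inj₂ (there ab′) = Adj-++⁺ʳ p 0 q ab′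

    inDescent′ : ∀ x → 1 ≤ x → x ≤ k → S x ≡ true → InDescent (p ++ 0 ∷ q) x
    inDescent′ x 1≤x x≤ x∈S with inDescent wf x 1≤x (m≤n⇒m≤1+n x≤) x∈S
    ... | a , b , ab , w = a , b , transport x a b 1≤x x≤ w ab , w

  wf-remove-bottom-at : ∀ {k} p q → kind (suc k) ≡ bottom → WellFormed (suc k) (p ++ openSlot (suc k) (0 ∷ q)) →
                        ∃[ u ] (WellFormed k u × p ++ openSlot (suc k) (0 ∷ q) ∈ rewriteSlot (openSlot (suc k)) u)
  wf-remove-bottom-at {k} p q kind≡ wf = p ++ 0 ∷ q , record
    { letters = LettersUpTo-remove (letters wf) λ x 1≤x →
        trans (occ-open x p (suc k) q) (occ-0∷ (suc k ∷ p ++ 0 ∷ q) 1≤x)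
    ; good = good′
    ; inDescent = inDescent′
    ; endsWith0 = EndsWith0-++⁺ p (EndsWith0-++⁻ p 0 (suc k ∷ 0 ∷ q) (endsWith0 wf))
    ; slots = suc-injective (trans (sym (occ-open 0 p (suc k) q)) (trans (slots wf) (cong suc (innerSlots-suc k kind≡))))
    } , ∈-rewriteSlot⁺ (openSlot (suc k)) p q
    where
    good′ : ∀ a b → Adj a b (p ++ 0 ∷ q) → GoodPair a b
    good′ a b ab with Adj-++-∷⁻ p 0 q ab
    ... | inj₁ ab′ = good wf a b (Adj-++-∷⁺ˡ p 0 (suc k ∷ 0 ∷ q) ab′)
    ... | inj₂ ab′ = good wf a b (Adj-++⁺ʳ p 0 (suc k ∷ 0 ∷ q) (there (there ab′)))

    transport : ∀ x a b → 1 ≤ x → x ≤ k → Witness x a b →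
                Adj a b (p ++ 0 ∷ suc k ∷ 0 ∷ q) → Adj a b (p ++ 0 ∷ q)
    transport x a b 1≤x x≤ w ab with Adj-++-∷⁻ p 0 (suc k ∷ 0 ∷ q) ab
    ... | inj₁ ab′ = Adj-++-∷⁺ˡ p 0 q ab′
    ... | inj₂ (there (there ab′)) = Adj-++⁺ʳ p 0 q ab′
    ... | inj₂ (here refl) with w
    ...   | inj₁ (refl , _) = ⊥-elim (<-irrefl refl 1≤x)
    ...   | inj₂ (refl , _) = ⊥-elim (<-irrefl refl x≤)
    transport x a b 1≤x x≤ w ab | inj₂ (there (here refl)) with w
    ...   | inj₁ (refl , _) = ⊥-elim (<-irrefl refl x≤)
    ...   | inj₂ (refl , _) = ⊥-elim (<-irrefl refl 1≤x)

    inDescent′ : ∀ x → 1 ≤ x → x ≤ k → S x ≡ true → InDescent (p ++ 0 ∷ q) x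
    inDescent′ x 1≤x x≤ x∈S with inDescent wf x 1≤x (m≤n⇒m≤1+n x≤) x∈S
    ... | a , b , ab , w = a , b , transport x a b 1≤x x≤ w ab , w

  wf-remove-bottom : ∀ {k t} → kind (suc k) ≡ bottom → WellFormed (suc k) t →
                     ∃[ u ] (WellFormed k u × t ∈ rewriteSlot (openSlot (suc k)) u)
  wf-remove-bottom {k} kind≡ wf with maxLetter-followedBySlot wf (¬Bottom×Top (bottom⇒Bottom (suc k) kind≡))
  ... | p , q , refl , i∉p , i∉q with inDescent wf (suc k) (s≤s z≤n) ≤-refl (proj₂ (bottom⇒Bottom (suc k) kind≡))
  ... | a , b , ab , inj₁ (refl , 1≤b , b<i) = ⊥-elim (¬Bottom×Top (bottom⇒Bottom (suc k) kind≡) (proj₁ (proj₁ (good wf a b ab) 1≤b b<i)))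
  ... | a , b , ab , inj₂ (refl , inj₂ i<a) = ⊥-elim (∈⇒≯ (letters wf) (Adj⇒∈ˡ _ ab) i<a)
  ... | a , b , ab , inj₂ (refl , inj₁ refl) with Adj-predecessor p (0 ∷ q) i∉p i∉q ab
  ... | p′ , refl rewrite ++-assoc p′ [ 0 ] (suc k ∷ 0 ∷ q) = wf-remove-bottom-at p′ q kind≡ wf

  wf-remove-top-at : ∀ {k} p y q → kind (suc k) ≡ top → 0 < innerSlots k → Bottom y →
                     WellFormed (suc k) (p ++ suc k ∷ y ∷ q) →
                     ∃[ u ] (WellFormed k u × p ++ suc k ∷ y ∷ q ∈ fillSlot (suc k) u)
  wf-remove-top-at {k} p y q kind≡ slot>0 bottom-y wf = p ++ 0 ∷ y ∷ q , record
    { letters = LettersUpTo-remove (letters wf) (λ x → occ-fill x p (suc k) y q)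
    ; good = good′
    ; inDescent = inDescent′
    ; endsWith0 = EndsWith0-++⁺ p (EndsWith0-++⁻ p (suc k) (y ∷ q) (endsWith0 wf))
    ; slots = slots′
    } , ∈-fillSlot⁺ (suc k) p y q
    where
    good′ : ∀ a b → Adj a b (p ++ 0 ∷ y ∷ q) → GoodPair a b
    good′ a b ab with Adj-++-∷⁻ p 0 (y ∷ q) ab
    ... | inj₁ ab′ with Adj-∷ʳ⁻ p 0 ab′
    ... | inj₁ ab″ = good wf a b (Adj-++⁺ˡ p (suc k ∷ y ∷ q) ab″)
    ... | inj₂ (refl , p′ , refl) =
          (λ ())
        , (λ { refl → ⊥-elim (¬Bottom×Top (proj₂ (good wf 0 (suc k) (Adj-∷ʳ-++ p′ (y ∷ q))) refl) (top⇒Top (suc k) kind≡)) })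
    good′ a b ab | inj₂ (here refl) = (λ _ ()) , (λ _ → bottom-y)
    good′ a b ab | inj₂ (there ab′) = good wf a b (Adj-++⁺ʳ p (suc k) (y ∷ q) (there ab′))

    inDescent′ : ∀ x → 1 ≤ x → x ≤ k → S x ≡ true → InDescent (p ++ 0 ∷ y ∷ q) x
    inDescent′ x 1≤x x≤ x∈S with inDescent wf x 1≤x (m≤n⇒m≤1+n x≤) x∈S
    ... | a , b , ab , w with Adj-++-∷⁻ p (suc k) (y ∷ q) ab
    ... | inj₁ ab′ with Adj-∷ʳ⁻ p (suc k) ab′
    ... | inj₁ ab″ = a , b , Adj-++⁺ˡ p (0 ∷ y ∷ q) ab″ , w
    ... | inj₂ (refl , _) with w
    ...   | inj₁ (_ , _ , i<x) = ⊥-elim (<⇒≱ i<x (m≤n⇒m≤1+n x≤))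
    ...   | inj₂ (refl , _) = ⊥-elim (<-irrefl refl x≤)
    inDescent′ x 1≤x x≤ x∈S | a , b , ab , w | inj₂ (here refl) with w
    ... | inj₁ (refl , _) = ⊥-elim (<-irrefl refl x≤)
    ... | inj₂ (refl , _) = 0 , b , Adj-++⁺ʳ p 0 (b ∷ q) (here refl) , inj₂ (refl , inj₁ refl)
    inDescent′ x 1≤x x≤ x∈S | a , b , ab , w | inj₂ (there ab′) = a , b , Adj-++⁺ʳ p 0 (y ∷ q) (there ab′) , w

    slots′ : occ 0 (p ++ 0 ∷ y ∷ q) ≡ suc (innerSlots k)
    slots′ = begin
      occ 0 (p ++ 0 ∷ y ∷ q)        ≡⟨ occ-++-∷ 0 p 0 (y ∷ q) ⟩
      suc (occ 0 (p ++ y ∷ q))      ≡⟨ cong suc (occ-++-∷ 0 p (suc k) (y ∷ q)) ⟨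
      suc (occ 0 (p ++ suc k ∷ y ∷ q)) ≡⟨ cong suc (slots wf) ⟩
      suc (suc (innerSlots (suc k))) ≡⟨ cong (suc ∘ suc) (innerSlots-suc k kind≡) ⟩
      suc (suc (innerSlots k ∸ 1))  ≡⟨ cong suc (suc-pred (innerSlots k) ⦃ >-nonZero slot>0 ⦄) ⟩
      suc (innerSlots k)            ∎
      where open ≡-Reasoning

  wf-remove-top : ∀ {k t} → kind (suc k) ≡ top → 0 < innerSlots k → WellFormed (suc k) t →
                  ∃[ u ] (WellFormed k u × t ∈ fillSlot (suc k) u)
  wf-remove-top {k} kind≡ slot>0 wf with maxLetter-split wf
  ... | p , r , refl , i∉p , i∉r with inDescent wf (suc k) (s≤s z≤n) ≤-refl (proj₂ (top⇒Top (suc k) kind≡))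
  ... | a , b , ab , inj₂ (refl , inj₂ i<a) = ⊥-elim (∈⇒≯ (letters wf) (Adj⇒∈ˡ _ ab) i<a)
  ... | a , b , ab , inj₂ (refl , inj₁ refl) = ⊥-elim (¬Bottom×Top (proj₂ (good wf 0 b ab) refl) (top⇒Top (suc k) kind≡))
  ... | a , b , ab , inj₁ (refl , 1≤b , b<i) with Adj-successor p r i∉p i∉r ab
  ... | q , refl = wf-remove-top-at p b q kind≡ slot>0 (proj₂ (proj₁ (good wf a b ab) 1≤b b<i)) wf

  wf-insert : ∀ {k u t} → WellFormed k u → t ∈ insert (kind (suc k)) (suc k) u → WellFormed (suc k) t
  wf-insert {k} wf t∈ with kind (suc k) in kind≡
  ... | free = wf-insert-free kind≡ wf t∈
  ... | bottom = wf-insert-bottom kind≡ wf t∈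
  ... | top = wf-insert-top kind≡ wf t∈

  wf-remove : ∀ {k t} → (kind (suc k) ≡ top → 0 < innerSlots k) → WellFormed (suc k) t →
              ∃[ u ] (WellFormed k u × t ∈ insert (kind (suc k)) (suc k) u)
  wf-remove {k} slot>0 wf with kind (suc k) in kind≡
  ... | free = wf-remove-free kind≡ wf
  ... | bottom = wf-remove-bottom kind≡ wf
  ... | top = wf-remove-top kind≡ (slot>0 refl) wf

  insert-injective : ∀ {k u v t} → WellFormed k u → WellFormed k v →
                     t ∈ insert (kind (suc k)) (suc k) u → t ∈ insert (kind (suc k)) (suc k) v → u ≡ v
  insert-injective {k} wf-u wf-v with kind (suc k)
  ... | free = rewriteSlot-∷-injective (none (letters wf-u) (suc k) ≤-refl) (none (letters wf-v) (suc k) ≤-refl)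
  ... | bottom = rewriteSlot-open-injective (none (letters wf-u) (suc k) ≤-refl) (none (letters wf-v) (suc k) ≤-refl)
  ... | top = fillSlot-injective (none (letters wf-u) (suc k) ≤-refl) (none (letters wf-v) (suc k) ≤-refl)

  Unique-insert : ∀ {k u} → WellFormed k u → Unique (insert (kind (suc k)) (suc k) u)
  Unique-insert {k} {u} wf with kind (suc k)
  ... | free = Unique-rewriteSlot-∷ k u
  ... | bottom = Unique-rewriteSlot-open k u (none (letters wf) (suc k) ≤-refl)
  ... | top = Unique-fillSlot k u

  length-insert : ∀ {k u} → WellFormed k u →
                  length (insert (kind (suc k)) (suc k) u) ≡ choices (kind (suc k)) (innerSlots k)
  length-insert {k} {u} wf with kind (suc k)
  ... | free = trans (length-rewriteSlot _ u) (slots wf)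
  ... | bottom = trans (length-rewriteSlot _ u) (slots wf)
  ... | top = suc-injective (trans (length-fillSlot _ u (endsWith0 wf)) (slots wf))

  wf-[0] : WellFormed 0 [ 0 ]
  wf-[0] = record
    { letters = record { once = λ { (suc _) _ () } ; none = λ { (suc _) _ → refl } }
    ; good = λ _ _ ()
    ; inDescent = λ { (suc _) _ () _ }
    ; endsWith0 = refl
    ; slots = refl
    }

  words-wf : ∀ i {t} → t ∈ words i → WellFormed i t
  words-wf zero (here refl) = wf-[0]
  words-wf (suc k) t∈ with find (∈-concatMap⁻ _ {xs = words k} t∈)
  ... | u , u∈ , t∈u = wf-insert (words-wf k u∈) t∈u

  words-complete : ∀ i → (∀ k → k < i → kind (suc k) ≡ top → 0 < innerSlots k) →
                   ∀ {t} → WellFormed i t → t ∈ words i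
  words-complete zero _ {t} wf rewrite occ⇒≡[0] t (none (letters wf)) (slots wf) = here refl
  words-complete (suc k) slot>0 wf with wf-remove (slot>0 k ≤-refl) wf
  ... | u , wf-u , t∈u = ∈-concatMap⁺ _ (lose (words-complete k (λ j j<k → slot>0 j (m<n⇒m<1+n j<k)) wf-u) t∈u)

  Unique-words : ∀ i → Unique (words i)
  Unique-words zero = [] ∷ []
  Unique-words (suc k) = Unique-concatMap⁺ _ (Unique-words k) (Unique-insert ∘ words-wf k)
    (λ u∈ v∈ → insert-injective (words-wf k u∈) (words-wf k v∈))

  choiceProduct : ℕ → ℕ
  choiceProduct zero = 1
  choiceProduct (suc k) = choiceProduct k * choices (kind (suc k)) (innerSlots k)

  length-words : ∀ i → length (words i) ≡ choiceProduct i
  length-words zero = refl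
  length-words (suc k) = trans (length-concatMap-const _ _ (words k) (length-insert ∘ words-wf k))
    (cong (_* choices (kind (suc k)) (innerSlots k)) (length-words k))

-- Counting the choices

indicator : Bool → ℕ
indicator b = if b then 1 else 0

top-balance : ∀ s o {F G c} → kindOf s o ≡ top → F ≡ G + c →
              G + indicator (s ∧ not o) ≤ F + indicator (s ∧ o) → 0 < c
top-balance true false {G = G} {c} _ refl G+1≤G+c+0 = +-cancelˡ-≤ G 1 c (≤-trans G+1≤G+c+0 (≤-reflexive (+-identityʳ _)))

-- One step of the counts f and g, where c = f - g is the number of inner slots.
balance-step : ∀ s o {F G} c → F ≡ G + c → G + indicator (s ∧ not o) ≤ F + indicator (s ∧ o) →
               F + indicator (s ∧ o) ≡ G + indicator (s ∧ not o) + nextInnerSlots (kindOf s o) c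
balance-step false o {G = G} c refl _ = trans (+-identityʳ (G + c)) (cong (_+ c) (sym (+-identityʳ G)))
balance-step true true {G = G} c refl _ = trans (+-assoc G c 1) (cong₂ _+_ (sym (+-identityʳ G)) (+-comm c 1))
balance-step true false zero refl G+1≤G+0 with top-balance true false {c = zero} refl refl G+1≤G+0
... | ()
balance-step true false {G = G} (suc c) refl _ = trans (+-identityʳ (G + suc c)) (sym (+-assoc G 1 c))

[+m+n]-[+m]≡+n : ∀ m n → (+ (m + n)) ℤ.- (+ m) ≡ + n
[+m+n]-[+m]≡+n m n = trans (ℤ.[+m]-[+n]≡m⊖n (m + n) m) (trans (ℤ.⊖-≥ (m≤m+n m n)) (cong +_ (m+n∸m≡n m n)))

sVec-step : ∀ s o {F G} c → F ≡ G + c →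
  (if s ∧ not o then (+ F) ℤ.- (+ G) else ((+ F) ℤ.- (+ G)) ℤ.+ (+ 1)) ≡ + choices (kindOf s o) c
sVec-step true false {G = G} c refl = [+m+n]-[+m]≡+n G c
sVec-step false _ {G = G} c refl = trans (cong (ℤ._+ + 1) ([+m+n]-[+m]≡+n G c)) (cong +_ (+-comm c 1))
sVec-step true true {G = G} c refl = trans (cong (ℤ._+ + 1) ([+m+n]-[+m]≡+n G c)) (cong +_ (+-comm c 1))

range-suc : ∀ m → range (suc m) ≡ range m ∷ʳ suc m
range-suc m = trans (cong (map suc) (sym (upTo-∷ʳ m))) (map-++ suc (upTo m) [ m ])

productℤ-++ : ∀ xs ys → productℤ (xs ++ ys) ≡ productℤ xs ℤ.* productℤ ys
productℤ-++ [] ys = sym (ℤ.*-identityˡ _)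
productℤ-++ (x ∷ xs) ys = trans (cong (x ℤ.*_) (productℤ-++ xs ys)) (sym (ℤ.*-assoc x _ _))

module Counting (S : ℕ → Bool) (N : ℕ)
  (ballot : ∀ i → 1 ≤ i → i ≤ N → gS S (suc i) ≤ fS S (suc i)) where
  open Construction S

  fS≡gS+innerSlots : ∀ k → k ≤ N → fS S (suc k) ≡ gS S (suc k) + innerSlots k
  fS≡gS+innerSlots zero _ = refl
  fS≡gS+innerSlots (suc k) k<N = balance-step (S (suc k)) (isOdd (suc k)) (innerSlots k)
    (fS≡gS+innerSlots k (≤-trans (n≤1+n k) k<N)) (ballot (suc k) (s≤s z≤n) k<N)

  top⇒innerSlots>0 : ∀ k → k < N → kind (suc k) ≡ top → 0 < innerSlots k
  top⇒innerSlots>0 k k<N kind≡ = top-balance (S (suc k)) (isOdd (suc k)) kind≡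
    (fS≡gS+innerSlots k (≤-trans (n≤1+n k) k<N)) (ballot (suc k) (s≤s z≤n) k<N)

  sVec≡choices : ∀ k → k < N → sVec S (suc k) ≡ + choices (kind (suc k)) (innerSlots k)
  sVec≡choices k k<N = sVec-step (S (suc k)) (isOdd (suc k)) (innerSlots k) (fS≡gS+innerSlots k (<⇒≤ k<N))

  productℤ-sVec : ∀ m → m ≤ N → productℤ (map (sVec S) (range m)) ≡ + choiceProduct m
  productℤ-sVec zero _ = refl
  productℤ-sVec (suc m) m<N = begin
    productℤ (map (sVec S) (range (suc m)))                          ≡⟨ cong (productℤ ∘ map (sVec S)) (range-suc m) ⟩
    productℤ (map (sVec S) (range m ∷ʳ suc m))                       ≡⟨ cong productℤ (map-++ (sVec S) (range m) [ suc m ]) ⟩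
    productℤ (map (sVec S) (range m) ∷ʳ sVec S (suc m))              ≡⟨ productℤ-++ (map (sVec S) (range m)) _ ⟩
    productℤ (map (sVec S) (range m)) ℤ.* (sVec S (suc m) ℤ.* + 1)    ≡⟨ cong₂ ℤ._*_ (productℤ-sVec m (<⇒≤ m<N)) (ℤ.*-identityʳ _) ⟩
    + choiceProduct m ℤ.* sVec S (suc m)                              ≡⟨ cong (+ choiceProduct m ℤ.*_) (sVec≡choices m m<N) ⟩
    + choiceProduct m ℤ.* + choices (kind (suc m)) (innerSlots m)     ≡⟨ ℤ.pos-* (choiceProduct m) _ ⟨
    + choiceProduct (suc m)                                           ∎
    where open ≡-Reasoning

-- From words to permutations

dropZeros : List ℕ → List ℕ
dropZeros [] = []
dropZeros (zero ∷ r) = dropZeros r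
dropZeros (suc x ∷ r) = suc x ∷ dropZeros r

dropZeros-∷ʳ0 : ∀ σ → occ 0 σ ≡ 0 → dropZeros (σ ∷ʳ 0) ≡ σ
dropZeros-∷ʳ0 [] _ = refl
dropZeros-∷ʳ0 (suc x ∷ σ) σ∌0 = cong (suc x ∷_) (dropZeros-∷ʳ0 σ σ∌0)

occ0≡0⇒>0 : ∀ {σ x} → occ 0 σ ≡ 0 → x ∈ σ → 1 ≤ x
occ0≡0⇒>0 {σ} {zero} σ∌0 0∈σ = ⊥-elim (occ≡0⇒∉ σ σ∌0 0∈σ)
occ0≡0⇒>0 {x = suc _} _ _ = s≤s z≤n

occ-∷ʳ0 : ∀ x σ → 1 ≤ x → occ x (σ ∷ʳ 0) ≡ occ x σ
occ-∷ʳ0 x σ 1≤x = trans (occ-++ x σ [ 0 ]) (trans (cong (_+_ (occ x σ)) (occ-0∷ [] 1≤x)) (+-identityʳ _))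

Adj-∷ʳ0⁻ : ∀ {a b} σ → 1 ≤ b → Adj a b (σ ∷ʳ 0) → Adj a b σ
Adj-∷ʳ0⁻ σ 1≤b ab with Adj-∷ʳ⁻ σ 0 ab
... | inj₁ ab′ = ab′
... | inj₂ (refl , _) = ⊥-elim (<-irrefl refl 1≤b)

odd⇒suc≡2* : ∀ b → isOdd b ≡ true → ∃[ j ] suc b ≡ 2 * j
odd⇒suc≡2* (suc zero) _ = 1 , refl
odd⇒suc≡2* (suc (suc b)) odd with odd⇒suc≡2* b (trans (sym (not-involutive (isOdd b))) odd)
... | j , eq = suc j , trans (cong (_+_ 2) eq) (sym (*-suc 2 j))

isOdd-+2 : ∀ b → isOdd (b + 2) ≡ isOdd b
isOdd-+2 b = trans (cong isOdd (+-comm b 2)) (not-involutive (isOdd b))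

module _ (S : ℕ → Bool) (n : ℕ) where
  open Construction S

  -- A top t and a bottom b < t have opposite parities, so t - b is odd; t - b = 1 would put
  -- both 2j - 1 and 2j into S.
  top-bottom-gap : (∀ x → S x ≡ true → 1 ≤ x × x ≤ 2 * n) →
                   (∀ j → 1 ≤ j → j ≤ n → ¬ ((S (2 * j ∸ 1) ≡ true) × (S (2 * j) ≡ true))) →
                   ∀ {t b} → Top t → Bottom b → b < t → 3 ≤ t ∸ b
  top-bottom-gap ⊆[2n] ¬pair {t} {b} (t-even , t∈S) (b-odd , b∈S) b<t
    with t ∸ b | m+[n∸m]≡n (<⇒≤ b<t) | m<n⇒0<n∸m b<t
  ... | suc (suc (suc _)) | _ | _ = s≤s (s≤s (s≤s z≤n))
  ... | 2 | b+2≡t | _ with trans (sym b-odd) (trans (sym (isOdd-+2 b)) (trans (cong isOdd b+2≡t) t-even))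
  ...   | ()
  top-bottom-gap ⊆[2n] ¬pair {t} {b} (t-even , t∈S) (b-odd , b∈S) b<t | 1 | b+1≡t | _
    with odd⇒suc≡2* b b-odd
  ... | zero , ()
  ... | suc h , 1+b≡2j =
    ⊥-elim (¬pair (suc h) (s≤s z≤n) j≤n (subst (λ x → S x ≡ true) (cong (_∸ 1) 1+b≡2j) b∈S , subst (λ x → S x ≡ true) t≡2j t∈S))
    where
    t≡2j : t ≡ 2 * suc h
    t≡2j = trans (sym b+1≡t) (trans (+-comm b 1) 1+b≡2j)
    j≤n : suc h ≤ n
    j≤n = *-cancelˡ-≤ 2 (subst (_≤ 2 * n) t≡2j (proj₂ (⊆[2n] t t∈S)))

occ0-range : ∀ m → occ 0 (range m) ≡ 0
occ0-range zero = refl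
occ0-range (suc m) = trans (cong (occ 0) (range-suc m)) (trans (occ-++ 0 (range m) [ suc m ]) (cong (_+ 0) (occ0-range m)))

LettersUpTo-range : ∀ m → LettersUpTo m (range m)
LettersUpTo-range zero = record { once = λ { (suc _) _ () } ; none = λ { (suc _) _ → refl } }
LettersUpTo-range (suc m) = LettersUpTo-insert (LettersUpTo-range m) λ x _ →
  trans (cong (occ x) (range-suc m))
    (trans (occ-++-∷ x (range m) (suc m) []) (cong (occ x ∘ (suc m ∷_)) (++-identityʳ (range m))))

module Enumeration (S : ℕ → Bool) (n : ℕ)
  (⊆[2n] : ∀ x → S x ≡ true → (1 ≤ x) × (x ≤ 2 * n))
  (balanced : fS S (suc (2 * n)) ≡ gS S (suc (2 * n)))
  (¬pair : ∀ j → 1 ≤ j → j ≤ n → ¬ ((S (2 * j ∸ 1) ≡ true) × (S (2 * j) ≡ true)))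
  (ballot : ∀ i → 1 ≤ i → i ≤ 2 * n → gS S (suc i) ≤ fS S (suc i))
  where

  open Construction S
  open WellFormed
  open Counting S (2 * n) ballot

  innerSlots-2n≡0 : innerSlots (2 * n) ≡ 0
  innerSlots-2n≡0 = +-cancelˡ-≡ (gS S (suc (2 * n))) _ 0
    (trans (sym (fS≡gS+innerSlots (2 * n) ≤-refl)) (trans balanced (sym (+-identityʳ _))))

  wf⇒∷ʳ0 : ∀ {t} → WellFormed (2 * n) t → ∃[ σ ] (t ≡ σ ∷ʳ 0 × occ 0 σ ≡ 0)
  wf⇒∷ʳ0 {t} wf with EndsWith0⇒∷ʳ t (endsWith0 wf)
  ... | σ , refl = σ , refl , +-cancelʳ-≡ 1 (occ 0 σ) 0
    (trans (sym (occ-++ 0 σ [ 0 ])) (trans (slots wf) (cong suc innerSlots-2n≡0)))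

  module _ {σ} (σ∌0 : occ 0 σ ≡ 0) (wf : WellFormed (2 * n) (σ ∷ʳ 0)) where

    descent⇒Top×Bottom : ∀ {a b} → IsDescentPair σ a b → Top a × Bottom b
    descent⇒Top×Bottom (ab , b<a) = proj₁ (good wf _ _ (Adj-++⁺ˡ σ [ 0 ] ab)) (occ0≡0⇒>0 σ∌0 (Adj⇒∈ʳ σ ab)) b<a

    wf⇒↭range : σ ↭ range (2 * n)
    wf⇒↭range = occ⇒↭ σ (range (2 * n)) same
      where
      same : ∀ x → occ x σ ≡ occ x (range (2 * n))
      same zero = trans σ∌0 (sym (occ0-range (2 * n)))
      same x@(suc _) with x ≤? 2 * n
      ... | yes x≤ = trans (sym (occ-∷ʳ0 x σ (s≤s z≤n)))
                       (trans (once (letters wf) x (s≤s z≤n) x≤) (sym (once (LettersUpTo-range (2 * n)) x (s≤s z≤n) x≤)))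
      ... | no x≰ = trans (sym (occ-∷ʳ0 x σ (s≤s z≤n)))
                       (trans (none (letters wf) x (≰⇒> x≰)) (sym (none (LettersUpTo-range (2 * n)) x (≰⇒> x≰))))

    wf⇒InX : InX n σ
    wf⇒InX = wf⇒↭range , λ a b ab → let (a-even , _) , (b-odd , _) = descent⇒Top×Bottom ab in cong not a-even , b-odd

    wf⇒Primary : Primary σ
    wf⇒Primary t b (_ , tb′) (_ , t′b) =
      top-bottom-gap S n ⊆[2n] ¬pair (proj₁ (descent⇒Top×Bottom tb′)) (proj₂ (descent⇒Top×Bottom t′b))

    wf⇒DescentSetIs : DescentSetIs σ S
    wf⇒DescentSetIs x = toS , fromS
      where
      toS : DescentTop σ x ⊎ DescentBottom σ x → S x ≡ true
      toS (inj₁ (_ , xb)) = proj₂ (proj₁ (descent⇒Top×Bottom xb))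
      toS (inj₂ (_ , ax)) = proj₂ (proj₂ (descent⇒Top×Bottom ax))
      fromS : S x ≡ true → DescentTop σ x ⊎ DescentBottom σ x
      fromS x∈S with inDescent wf x (proj₁ (⊆[2n] x x∈S)) (proj₂ (⊆[2n] x x∈S)) x∈S
      ... | a , b , ab , inj₁ (refl , 1≤b , b<x) = inj₁ (b , Adj-∷ʳ0⁻ σ 1≤b ab , b<x)
      ... | a , b , ab , inj₂ (refl , inj₂ x<a) = inj₂ (a , Adj-∷ʳ0⁻ σ (proj₁ (⊆[2n] x x∈S)) ab , x<a)
      ... | a , b , ab , inj₂ (refl , inj₁ refl) = ⊥-elim (occ≡0⇒∉ σ σ∌0 (Adj⇒∈ˡ σ (Adj-∷ʳ0⁻ σ (proj₁ (⊆[2n] x x∈S)) ab)))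

  InX⇒occ0≡0 : ∀ {σ} → InX n σ → occ 0 σ ≡ 0
  InX⇒occ0≡0 (σ↭range , _) = trans (occ-↭ σ↭range 0) (occ0-range (2 * n))

  InX⇒wf : ∀ {σ} → InX n σ → DescentSetIs σ S → WellFormed (2 * n) (σ ∷ʳ 0)
  InX⇒wf {σ} inX@(σ↭range , parities) descentSet = record
    { letters = record
      { once = λ x 1≤x x≤ → trans (occ-∷ʳ0 x σ 1≤x)
                              (trans (occ-↭ σ↭range x) (once (LettersUpTo-range (2 * n)) x 1≤x x≤))
      ; none = λ x 2n<x → trans (occ-∷ʳ0 x σ (≤-trans (s≤s z≤n) 2n<x))
                            (trans (occ-↭ σ↭range x) (none (LettersUpTo-range (2 * n)) x 2n<x))
      }
    ; good = good′
    ; inDescent = inDescent′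
    ; endsWith0 = EndsWith0-∷ʳ σ
    ; slots = trans (occ-++ 0 σ [ 0 ]) (trans (cong (_+ 1) (InX⇒occ0≡0 inX)) (cong suc (sym innerSlots-2n≡0)))
    }
    where
    σ∌0 : occ 0 σ ≡ 0
    σ∌0 = InX⇒occ0≡0 inX

    good′ : ∀ a b → Adj a b (σ ∷ʳ 0) → GoodPair a b
    good′ a b ab with Adj-∷ʳ⁻ σ 0 ab
    ... | inj₁ ab′ = (λ _ b<a → let a-even , b-odd = parities a b (ab′ , b<a) in
                         (trans (sym (not-involutive _)) (cong not a-even) , proj₁ (descentSet a) (inj₁ (b , ab′ , b<a)))
                       , (b-odd , proj₁ (descentSet b) (inj₂ (a , ab′ , b<a))))
                   , (λ { refl → ⊥-elim (occ≡0⇒∉ σ σ∌0 (Adj⇒∈ˡ σ ab′)) })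
    ... | inj₂ (refl , σ′ , refl) = (λ ()) , (λ { refl → ⊥-elim (occ≡0⇒∉ σ σ∌0 (∈-++⁺ʳ σ′ (here refl))) })

    inDescent′ : ∀ x → 1 ≤ x → x ≤ 2 * n → S x ≡ true → InDescent (σ ∷ʳ 0) x
    inDescent′ x _ _ x∈S with proj₂ (descentSet x) x∈S
    ... | inj₁ (b , xb , b<x) = x , b , Adj-++⁺ˡ σ [ 0 ] xb , inj₁ (refl , occ0≡0⇒>0 σ∌0 (Adj⇒∈ʳ σ xb) , b<x)
    ... | inj₂ (a , ax , x<a) = a , x , Adj-++⁺ˡ σ [ 0 ] ax , inj₂ (refl , inj₂ x<a)

  enumeration : List (List ℕ)
  enumeration = map dropZeros (words (2 * n))

  words-2n-shape : ∀ {t} → t ∈ words (2 * n) → ∃[ σ ] (t ≡ σ ∷ʳ 0 × occ 0 σ ≡ 0)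
  words-2n-shape {t} t∈ = wf⇒∷ʳ0 (words-wf (2 * n) t∈)

  Unique-enumeration : Unique enumeration
  Unique-enumeration = Unique.map⁻ (subst Unique (sym restore) (Unique-words (2 * n)))
    where
    restore : map (_∷ʳ 0) enumeration ≡ words (2 * n)
    restore = trans (sym (map-∘ (words (2 * n))))
                (map-id-local (All.tabulate λ t∈ → restore₁ (words-2n-shape t∈)))
      where
      restore₁ : ∀ {t} → ∃[ σ ] (t ≡ σ ∷ʳ 0 × occ 0 σ ≡ 0) → dropZeros t ∷ʳ 0 ≡ t
      restore₁ (σ , refl , σ∌0) = cong (_∷ʳ 0) (dropZeros-∷ʳ0 σ σ∌0)

  enumeration-sound : ∀ σ → σ ∈ enumeration → InX n σ × Primary σ × DescentSetIs σ S
  enumeration-sound _ σ∈ with ∈-map⁻ dropZeros σ∈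
  ... | t , t∈ , refl with words-2n-shape t∈
  ... | σ , refl , σ∌0 rewrite dropZeros-∷ʳ0 σ σ∌0 =
    let wf = words-wf (2 * n) t∈ in wf⇒InX σ∌0 wf , wf⇒Primary σ∌0 wf , wf⇒DescentSetIs σ∌0 wf

  enumeration-complete : ∀ σ → InX n σ → Primary σ → DescentSetIs σ S → σ ∈ enumeration
  enumeration-complete σ inX _ descentSet = subst (_∈ enumeration) (dropZeros-∷ʳ0 σ (InX⇒occ0≡0 inX))
    (∈-map⁺ dropZeros (words-complete (2 * n) top⇒innerSlots>0 (InX⇒wf inX descentSet)))

  length-enumeration : + length enumeration ≡ productℤ (map (sVec S) (range (2 * n)))
  length-enumeration = trans (cong +_ (trans (length-map dropZeros (words (2 * n))) (length-words (2 * n))))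
    (sym (productℤ-sVec (2 * n) ≤-refl))

proposition2p5 : (n : ℕ) (S : ℕ → Bool) → IsSignature n S →
    ∃[ L ] (Unique L
    × (∀ σ → σ ∈ L → InX n σ × Primary σ × DescentSetIs σ S)
    × (∀ σ → InX n σ → Primary σ → DescentSetIs σ S → σ ∈ L)
    × (+ length L ≡ productℤ (map (sVec S) (range (2 * n)))))
proposition2p5 n S (⊆[2n] , balanced , ¬pair , ballot) =
  enumeration , Unique-enumeration , enumeration-sound , enumeration-complete , length-enumeration
  where open Enumeration S n ⊆[2n] balanced ¬pair ballot
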